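{- Let $w\in S_n$. If $D\in RP(w)$ is a highest weight pipe dream, then $\operatorname{wt}(D)$ is a partition, i.e. $\operatorname{wt}(D)_1\ge\operatorname{wt}(D)_2\ge\cdots\ge\operatorname{wt}(D)_n$.
   Context: Index the boxes of the $n\times n$ grid by $(i,j)$, row $i$ from the top, column $j$ from the left. Pipe dreams. A pipe dream is a covering of each box by a cross tile or an elbow tile, where crosses are only allowed in boxes with $i+j\le n$. Connecting tiles gives pipes that enter at the left of each row and exit at the top of a column: a cross lets one pipe pass horizontally and one vertically; an elbow joins the left edge to the top edge and the bottom edge to the right edge. $D$ is a pipe dream for $w$ if the pipe entering row $i$ exits from column $w(i)$. It is reduced if any two pipes cross at most once. $RP(w)$ is the set of reduced pipe dreams for $w$, and $D_+$ is the set of boxes carrying crosses. $\operatorname{wt}(D)\in\mathbb Z^n$ has $i$-th coordinate equal to the number of crosses in row $i$. Pairing process on row $i$. The crosses of row $i$ are considered from right to left. The cross $(i,j)$ is paired with the leftmost not-yet-paired cross of row $i+1$ in a column $\ge j$, if one exists; otherwise it is unpaired. Crosses of row $i+1$ never paired are unpaired. Raising move $e_i$. If after this pairing every cross in row $i+1$ is paired, set $e_i(D)=0$. Otherwise let $(i+1,\ell)$ be the rightmost unpaired cross of row $i+1$, let $q>\ell$ be minimal with $(i+1,q)\notin D_+$, and set $e_i(D)_+=(D_+\setminus\{(i+1,\ell)\})\cup\{(i,q)\}$. $D$ is a highest weight pipe dream if $e_i(D)=0$ for all $1\le i<n$. -}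

module Defs where

open import Data.Nat using (ℕ; zero; suc; _+_; _≤_; _<_; _≡ᵇ_; _<ᵇ_; _≤ᵇ_)
open import Data.Bool using (Bool; true; false; _∧_; _∨_; not; if_then_else_)
open import Data.Product using (_×_; _,_; proj₁; proj₂)
open import Data.Maybe using (Maybe; just; nothing)
open import Data.List using (List; []; _∷_; length)
open import Data.Fin using (Fin; toℕ)
open import Data.Fin.Permutation using (Permutation′; _⟨$⟩ʳ_)
open import Relation.Binary.PropositionalEquality using (_≡_; _≢_)

-- Conventions: boxes are indexed 1-based by natural numbers (i , j),
-- row i from the top, column j from the left, as in the paper.
-- The set D₊ of crosses is a Boolean predicate on ℕ × ℕ.

Crosses : Set
Crosses = ℕ → ℕ → Bool

-- A pipe dream on the n×n grid: a set of crosses, all lying in boxes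
-- (i , j) with 1 ≤ i , 1 ≤ j , i + j ≤ n (all other boxes are elbows).
record PipeDream (n : ℕ) : Set where
  field
    cross   : Crosses
    support : ∀ i j → cross i j ≡ true → (1 ≤ i) × (1 ≤ j) × (i + j ≤ n)
open PipeDream public

data Dir : Set where
  fromLeft fromBottom : Dir

consBox : ℕ × ℕ → List (ℕ × ℕ) × Maybe ℕ → List (ℕ × ℕ) × Maybe ℕ
consBox b (p , e) = (b ∷ p) , e

-- trace n X fuel d r c : follow the pipe entering box (r , c) from side d.
-- Returns the list of boxes visited and (just c') if the pipe exits
-- through the top of column c', nothing if it leaves the grid otherwise.
-- A cross passes a pipe straight through; an elbow joins left–top and
-- bottom–right.
trace : ℕ → Crosses → ℕ → Dir → ℕ → ℕ → List (ℕ × ℕ) × Maybe ℕ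
trace n X zero d r c = [] , nothing
trace n X (suc f) d r c =
  if (n <ᵇ c) ∨ (r ≡ᵇ 0) then ([] , nothing)
  else consBox (r , c) (go d (X r c))
  where
  up : ℕ × ℕ → List (ℕ × ℕ) × Maybe ℕ
  up (zero , c′)        = [] , nothing
  up (suc zero , c′)    = [] , just c′
  up (suc (suc k) , c′) = trace n X f fromBottom (suc k) c′
  go : Dir → Bool → List (ℕ × ℕ) × Maybe ℕ
  go fromLeft   true  = trace n X f fromLeft r (suc c)
  go fromLeft   false = up (r , c)
  go fromBottom true  = up (r , c)
  go fromBottom false = trace n X f fromLeft r (suc c)

-- The pipe entering the left of row i (enough fuel to cross the grid).
pipe : (n : ℕ) → PipeDream n → ℕ → List (ℕ × ℕ) × Maybe ℕ
pipe n D i = trace n (cross D) (3 * n + 3) fromLeft i 1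
  where open Data.Nat using (_*_)

pipePath : (n : ℕ) → PipeDream n → ℕ → List (ℕ × ℕ)
pipePath n D i = proj₁ (pipe n D i)

pipeExit : (n : ℕ) → PipeDream n → ℕ → Maybe ℕ
pipeExit n D i = proj₂ (pipe n D i)

-- D is a pipe dream for w: the pipe entering row i exits column w(i)
-- (1-based rows/columns; Fin n is 0-based, hence the suc).
IsPipeDreamFor : (n : ℕ) → Permutation′ n → PipeDream n → Set
IsPipeDreamFor n w D =
  ∀ (i : Fin n) → pipeExit n D (suc (toℕ i)) ≡ just (suc (toℕ (w ⟨$⟩ʳ i)))

filterB : {A : Set} → (A → Bool) → List A → List A
filterB p [] = []
filterB p (x ∷ xs) = if p x then x ∷ filterB p xs else filterB p xs

boxEq : ℕ × ℕ → ℕ × ℕ → Bool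
boxEq (a , b) (c , d) = (a ≡ᵇ c) ∧ (b ≡ᵇ d)

memB : ℕ × ℕ → List (ℕ × ℕ) → Bool
memB b [] = false
memB b (x ∷ xs) = boxEq b x ∨ memB b xs

crossings : (n : ℕ) → PipeDream n → ℕ → ℕ → List (ℕ × ℕ)
crossings n D i i′ =
  filterB (λ b → cross D (proj₁ b) (proj₂ b) ∧ memB b (pipePath n D i′))
          (pipePath n D i)

Reduced : (n : ℕ) → PipeDream n → Set
Reduced n D = ∀ (i i′ : Fin n) → i ≢ i′ →
  length (crossings n D (suc (toℕ i)) (suc (toℕ i′))) ≤ 1

InRP : (n : ℕ) → Permutation′ n → PipeDream n → Set
InRP n w D = IsPipeDreamFor n w D × Reduced n D

upTo1 : ℕ → List ℕ
upTo1 zero = []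
upTo1 (suc n) = go (suc n) 1
  where
  go : ℕ → ℕ → List ℕ
  go zero k = []
  go (suc m) k = k ∷ go m (suc k)

reverseL : {A : Set} → List A → List A
reverseL = Data.List.reverse

rowCols : (n : ℕ) → Crosses → ℕ → List ℕ
rowCols n X i = filterB (X i) (upTo1 n)

wt : (n : ℕ) → PipeDream n → ℕ → ℕ
wt n D i = length (rowCols n (cross D) i)

-- Remove the leftmost element ≥ j from an ascending list of columns
-- (pairing cross (i , j) with it), if one exists.
pairWith : ℕ → List ℕ → List ℕ
pairWith j [] = []
pairWith j (x ∷ xs) = if j ≤ᵇ x then xs else x ∷ pairWith j (xs)

-- Process the crosses of row i from right to left; returns the
-- (ascending) list of columns of unpaired crosses of row i+1.
pairAll : List ℕ → List ℕ → List ℕ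
pairAll [] rest = rest
pairAll (j ∷ js) rest = pairAll js (pairWith j rest)

unpairedBelow : (n : ℕ) → Crosses → ℕ → List ℕ
unpairedBelow n X i =
  pairAll (reverseL (rowCols n X i)) (rowCols n X (suc i))

lastL : ℕ → List ℕ → ℕ
lastL d [] = d
lastL d (x ∷ xs) = lastL x xs

firstFree : Crosses → ℕ → ℕ → ℕ → ℕ
firstFree X row zero start = start
firstFree X row (suc f) start =
  if X row start then firstFree X row f (suc start) else start

-- e_i(D) as a set of crosses; nothing stands for e_i(D) = 0.
raise : (n : ℕ) → Crosses → ℕ → Maybe Crosses
raise n X i with unpairedBelow n X i
... | [] = nothing
... | (u ∷ us) =
  let ℓ = lastL u us
      q = firstFree X (suc i) (suc n) (suc ℓ)
  in just (λ a b → if (a ≡ᵇ suc i) ∧ (b ≡ᵇ ℓ) then false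
                   else if (a ≡ᵇ i) ∧ (b ≡ᵇ q) then true
                   else X a b)

HighestWeight : (n : ℕ) → PipeDream n → Set
HighestWeight n D = ∀ i → 1 ≤ i → i < n → raise n (cross D) i ≡ nothing

IsPartitionWt : (n : ℕ) → PipeDream n → Set
IsPartitionWt n D = ∀ i → 1 ≤ i → i < n → wt n D (suc i) ≤ wt n D i

{-# OPTIONS --safe #-}
-- Every cross of row i + 1 that gets paired is paired with its own cross of
-- row i, so pairing removes at most one cross of row i + 1 per cross of row i.
-- For a highest weight pipe dream no cross of row i + 1 stays unpaired, hence
-- row i + 1 has at most as many crosses as row i.
module Submission where

open import Defs
open import Data.Nat using (ℕ; suc; _+_; _≤_; _≤ᵇ_; z≤n; s≤s)
open import Data.Nat.Properties using (≤-refl; ≤-trans; +-identityʳ)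
open import Data.Bool using (true; false)
open import Data.List using (List; []; _∷_; length)
open import Data.List.Properties using (length-reverse)
open import Data.Maybe using (nothing)
open import Data.Fin.Permutation using (Permutation′)
open import Relation.Binary.PropositionalEquality using (_≡_; refl; cong; subst)
open import Relation.Binary.PropositionalEquality.Properties using (module ≡-Reasoning)

length-pairWith : ∀ j xs → length xs ≤ suc (length (pairWith j xs))
length-pairWith j []       = z≤n
length-pairWith j (x ∷ xs) with j ≤ᵇ x
... | true  = ≤-refl
... | false = s≤s (length-pairWith j xs)

length-pairAll : ∀ js rest → length rest ≤ length js + length (pairAll js rest)
length-pairAll []       rest = ≤-refl
length-pairAll (j ∷ js) rest =
  ≤-trans (length-pairWith j rest) (s≤s (length-pairAll js (pairWith j rest)))

raise≡nothing⇒unpairedBelow≡[] :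
  ∀ n X i → raise n X i ≡ nothing → unpairedBelow n X i ≡ []
raise≡nothing⇒unpairedBelow≡[] n X i eq with unpairedBelow n X i
... | []    = refl
... | _ ∷ _ with () ← eq

unpairedBelow≡[]⇒rowLength-≤ : ∀ n X i → unpairedBelow n X i ≡ [] →
  length (rowCols n X (suc i)) ≤ length (rowCols n X i)
unpairedBelow≡[]⇒rowLength-≤ n X i allPaired =
  subst (length below ≤_) lengthAbove (length-pairAll (reverseL above) below)
  where
  open ≡-Reasoning
  above below : List ℕ
  above = rowCols n X i
  below = rowCols n X (suc i)
  lengthAbove : length (reverseL above) + length (unpairedBelow n X i) ≡ length above
  lengthAbove = begin
    length (reverseL above) + length (unpairedBelow n X i)
      ≡⟨ cong (λ u → length (reverseL above) + length u) allPaired ⟩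
    length (reverseL above) + 0 ≡⟨ +-identityʳ _ ⟩
    length (reverseL above)     ≡⟨ length-reverse above ⟩
    length above                ∎

lemma2p14 : (n : ℕ) (w : Permutation′ n) (D : PipeDream n) →
    InRP n w D → HighestWeight n D → IsPartitionWt n D
lemma2p14 n w D _ highest i 1≤i i<n =
  unpairedBelow≡[]⇒rowLength-≤ n (cross D) i
    (raise≡nothing⇒unpairedBelow≡[] n (cross D) i (highest i 1≤i i<n))
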